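{- Let $k\geq 2$ be an integer, $\lambda$ a positive integer, and $a_{k,n}^{k}$ the $k$-th sequence of generalized order-$k$ numbers defined in the context. For $n\ge1$ let $D_{k,n}=(d_{st})$ be the $n\times n$ matrix with \[ d_{st}=\begin{cases}1&\text{if } -1\le s-t<k\text{ and } s\ne t,\\ \lambda&\text{if } s=t,\\ 0&\text{otherwise.}\end{cases} \] Then $\operatorname{per}(D_{k,n})=a_{k,n+1}^{k}$ for all $n\ge 1$, where $\operatorname{per}$ denotes the permanent.
   Context: For a positive integer $k$ and a positive integer $\lambda$, the $k$ sequences of generalized order-$k$ numbers are defined as follows: for each $1\le i\le k$, the sequence $(a_{k,n}^{i})_{n\ge 1-k}$ has initial values $a_{k,n}^{i}=1$ if $i=1-n$ and $a_{k,n}^{i}=0$ otherwise, for $1-k\le n\le 0$, and satisfies $a_{k,n}^{i}=\lambda a_{k,n-1}^{i}+a_{k,n-2}^{i}+\cdots+a_{k,n-k}^{i}$ for $n\ge 1$. The $k$-th sequence is the one with $i=k$. -}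

module Defs where

open import Data.Nat as ℕ using (ℕ; zero; suc; _+_; _*_; _∸_; _<ᵇ_; _≡ᵇ_)
open import Data.Integer as ℤ using (ℤ; +_; -[1+_]; _-_)
open import Data.Bool using (Bool; true; false; if_then_else_; _∧_)
open import Data.Fin as Fin using (Fin; toℕ)
open import Data.Fin.Properties using () renaming (_≟_ to _≟ᶠ_)
open import Data.Nat.ListAction using (sum; product)
open import Data.List as List using (List; []; _∷_; map; concatMap; filter; take; drop; allFin)
open import Data.Vec as Vec using (Vec; []; _∷_; lookup; toList)
open import Relation.Nullary.Decidable using (⌊_⌋)
import Data.List.Relation.Unary.Unique.DecPropositional as UniqueDec

-- We use a shifted index m = n + k - 1 ≥ 0 for the sequence (a^i_{k,n})_{n ≥ 1-k}.
-- hist k λ i m = [ b m , b (m-1) , … , b 0 ]   where  b m = a^i_{k, m-k+1}.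
--   * initial values (0 ≤ m ≤ k-1, i.e. 1-k ≤ n ≤ 0):
--       b m = 1 if i = 1 - n = k - m (i.e. m + i = k), else 0
--   * recurrence (m ≥ k, i.e. n ≥ 1):
--       b m = λ b(m-1) + b(m-2) + … + b(m-k)

initVal : (k i m : ℕ) → ℕ
initVal k i m = if (m + i) ≡ᵇ k then 1 else 0

hist : (k λ' i m : ℕ) → List ℕ
hist k λ' i zero = initVal k i zero ∷ []
hist k λ' i (suc m) with hist k λ' i m
... | h = (if suc m <ᵇ k
            then initVal k i (suc m)
            else λ' * headOr h + sum (take (k ∸ 1) (drop 1 h))) ∷ h
  where
  headOr : List ℕ → ℕ
  headOr [] = 0
  headOr (x ∷ _) = x

shifted : (k λ' i m : ℕ) → ℕ
shifted k λ' i m with hist k λ' i m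
... | [] = 0
... | x ∷ _ = x

-- a^i_{k,n} (with parameter λ) for an integer index n ≥ 1 - k;
-- for n < 1 - k (outside the domain) we return 0.
a : (k λ' i : ℕ) → ℤ → ℕ
a k λ' i n with n ℤ.+ (+ k) ℤ.- (+ 1)
... | + m = shifted k λ' i m
... | -[1+ _ ] = 0

allVecs : (n m : ℕ) → List (Vec (Fin n) m)
allVecs n zero = [] ∷ []
allVecs n (suc m) = concatMap (λ x → map (x ∷_) (allVecs n m)) (allFin n)

permutations : (n : ℕ) → List (Vec (Fin n) n)
permutations n = filter (λ v → UniqueDec.unique? (_≟ᶠ_ {n}) (toList v)) (allVecs n n)

Matrix : ℕ → Set
Matrix n = Fin n → Fin n → ℕ

per : {n : ℕ} → Matrix n → ℕ
per {n} M = sum (map (λ σ → product (map (λ s → M s (lookup σ s)) (allFin n))) (permutations n))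

-- The matrix D_{k,n}: d_{st} = λ if s = t; 1 if -1 ≤ s - t < k and s ≠ t; 0 otherwise.
-- (Indices s, t ∈ Fin n stand for 1..n shifted by one; only s - t matters.)

D : (k λ' n : ℕ) → Matrix n
D k λ' n s t with ⌊ s ≟ᶠ t ⌋
... | true = λ'
... | false =
  let δ = (+ toℕ s) - (+ toℕ t) in
  if ⌊ -[1+ 0 ] ℤ.≤? δ ⌋ ∧ ⌊ δ ℤ.<? (+ k) ⌋ then 1 else 0

-- Expand the permanent row by row. Since d_{st} = 0 for t > s + 1 and
-- d_{s,s+1} = 1, the first r rows of a contributing permutation occupy all
-- columns 0, …, r except one hole c ≤ r, and row r either fills the hole
-- (weight d_{rc}, which depends only on the gap g = r − c) or takes column
-- r + 1.  So the contribution P_m(g) of the remaining m rows satisfies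
-- P_{m+1}(g) = w(g) P_m(0) + P_m(g + 1) with w(0) = λ and w(g) = [g < k]
-- otherwise.  By a joint induction on m, P_m(0) = a^k_{k,m+1} and, for g ≥ 1,
-- P_m(g) is the sum of the k − g most recent terms a^k_{k,m}, a^k_{k,m−1}, …;
-- the two claims feed each other through the order-k recurrence.

module Submission where

open import Defs
open import Data.Nat using (ℕ; suc; _≤_; _+_)
open import Data.Integer using (+_)
open import Relation.Binary.PropositionalEquality using (_≡_)

open import Data.Nat using (zero; _*_; _∸_; _<_; _<ᵇ_; s≤s; z≤n; _≟_; _≤?_; _<?_)
import Data.Nat.Properties as ℕ
open import Data.Nat.ListAction using (sum; product)
open import Data.Nat.ListAction.Properties using (sum-++)
open import Data.Integer.Base as ℤ using (ℤ; -[1+_]; _-_; -_)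
import Data.Integer.Properties as ℤ
open import Data.Bool.Base using (Bool; true; false; if_then_else_; _∧_; _∨_; not)
open import Data.Bool.Properties using (∧-assoc; ∧-zeroʳ)
open import Data.Fin.Base as Fin using (Fin; toℕ; fromℕ<; punchIn; punchOut)
open import Data.Fin.Properties
  using (toℕ-injective; toℕ-fromℕ<; toℕ<n; punchInᵢ≢i; punchIn-punchOut; punchIn-injective)
  renaming (_≟_ to _≟ᶠ_)
open import Data.List.Base using (List; []; _∷_; _++_; map; concatMap; filter; allFin; tabulate; take; replicate)
open import Data.List.Properties using (map-++; map-∘; map-cong; map-tabulate; tabulate-cong)
import Data.List.Relation.Unary.All as All
import Data.List.Relation.Unary.Unique.DecPropositional as UniqueDec
open import Data.Vec.Base using (Vec; []; _∷_; lookup; toList)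
open import Algebra.Properties.CommutativeMonoid.Sum ℕ.+-0-commutativeMonoid
  using (sum-remove; sum-cong-≗; sum-replicate-zero)
  renaming (sum to ∑)
open import Data.Product.Base using (_×_; _,_; proj₁)
open import Data.Sum.Base using (_⊎_; inj₁; inj₂)
open import Function.Base using (_∘_; id)
open import Function.Bundles using (mk⇔)
open import Relation.Binary.PropositionalEquality
  using (refl; sym; trans; cong; cong₂; subst; _≢_; _≗_; module ≡-Reasoning)
open import Relation.Nullary.Decidable using (Dec; yes; no; ⌊_⌋; does; ¬?; _×-dec_; _⊎-dec_; dec-true; dec-false; does-⇔; isYes≗does; ⌊⌋-map′)

open ≡-Reasoning

∑-zero : ∀ {n} {h : Fin n → ℕ} → (∀ x → h x ≡ 0) → ∑ h ≡ 0
∑-zero {n} h≡0 = trans (sum-cong-≗ h≡0) (sum-replicate-zero n)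

∑-single : ∀ {n} (h : Fin n → ℕ) i → (∀ x → x ≢ i → h x ≡ 0) → ∑ h ≡ h i
∑-single {suc n} h i h≡0 = begin
  ∑ h                       ≡⟨ sum-remove {i = i} h ⟩
  h i + ∑ (h ∘ punchIn i)   ≡⟨ cong (_+_ (h i)) (∑-zero λ x → h≡0 (punchIn i x) (punchInᵢ≢i i x)) ⟩
  h i + 0                   ≡⟨ ℕ.+-identityʳ (h i) ⟩
  h i                       ∎

∑-pair : ∀ {n} (h : Fin n → ℕ) i j → i ≢ j → (∀ x → x ≢ i → x ≢ j → h x ≡ 0) → ∑ h ≡ h i + h j
∑-pair {suc n} h i j i≢j h≡0 = begin
  ∑ h                                  ≡⟨ sum-remove {i = i} h ⟩
  h i + ∑ (h ∘ punchIn i)              ≡⟨ cong (_+_ (h i)) (∑-single (h ∘ punchIn i) (punchOut i≢j) rest) ⟩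
  h i + h (punchIn i (punchOut i≢j))   ≡⟨ cong (λ y → h i + h y) (punchIn-punchOut i≢j) ⟩
  h i + h j                            ∎
  where
  rest : ∀ x → x ≢ punchOut i≢j → h (punchIn i x) ≡ 0
  rest x x≢ = h≡0 (punchIn i x) (punchInᵢ≢i i x) λ x↦j →
    x≢ (punchIn-injective i x _ (trans x↦j (sym (punchIn-punchOut i≢j))))

sum-tabulate : ∀ {n} (f : Fin n → ℕ) → sum (tabulate f) ≡ ∑ f
sum-tabulate {zero}  f = refl
sum-tabulate {suc n} f = cong (_+_ (f Fin.zero)) (sum-tabulate (f ∘ Fin.suc))

sum-map-allFin : ∀ {n} (f : Fin n → ℕ) → sum (map f (allFin n)) ≡ ∑ f
sum-map-allFin f = trans (cong sum (map-tabulate id f)) (sum-tabulate f)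

sum-map-concatMap : ∀ {A B : Set} (f : B → ℕ) (g : A → List B) xs →
  sum (map f (concatMap g xs)) ≡ sum (map (λ x → sum (map f (g x))) xs)
sum-map-concatMap f g []       = refl
sum-map-concatMap f g (x ∷ xs) = begin
  sum (map f (g x ++ concatMap g xs))               ≡⟨ cong sum (map-++ f (g x) (concatMap g xs)) ⟩
  sum (map f (g x) ++ map f (concatMap g xs))       ≡⟨ sum-++ (map f (g x)) (map f (concatMap g xs)) ⟩
  sum (map f (g x)) + sum (map f (concatMap g xs))  ≡⟨ cong (_+_ (sum (map f (g x)))) (sum-map-concatMap f g xs) ⟩
  sum (map f (g x)) + sum (map (λ y → sum (map f (g y))) xs) ∎

sum-map-*ˡ : ∀ {A : Set} c (f : A → ℕ) xs → sum (map (λ x → c * f x) xs) ≡ c * sum (map f xs)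
sum-map-*ˡ c f []       = sym (ℕ.*-zeroʳ c)
sum-map-*ˡ c f (x ∷ xs) = trans (cong (_+_ (c * f x)) (sum-map-*ˡ c f xs)) (sym (ℕ.*-distribˡ-+ c (f x) _))

sum-map-filter : ∀ {A : Set} {P : A → Set} (P? : ∀ x → Dec (P x)) (f : A → ℕ) xs →
  sum (map f (filter P? xs)) ≡ sum (map (λ x → if does (P? x) then f x else 0) xs)
sum-map-filter P? f []       = refl
sum-map-filter P? f (x ∷ xs) with does (P? x)
... | true  = cong (_+_ (f x)) (sum-map-filter P? f xs)
... | false = sum-map-filter P? f xs

*-if-0 : ∀ c b x → c * (if b then x else 0) ≡ (if b then c * x else 0)
*-if-0 c true  x = refl
*-if-0 c false x = ℕ.*-zeroʳ c

toℕ-≢ : ∀ {n} {x y : Fin n} {v} → x ≢ y → toℕ y ≡ v → toℕ x ≢ v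
toℕ-≢ x≢y y≡v x≡v = x≢y (toℕ-injective (trans x≡v (sym y≡v)))

Columns : ℕ → Set
Columns n = Fin n → Bool

_∪｛_｝ : ∀ {n} → Columns n → Fin n → Columns n
(F ∪｛ x ｝) y = F y ∨ does (x ≟ᶠ y)

module RowExpansion {n : ℕ} (e : ℕ → ℕ → ℕ) where

  open UniqueDec (_≟ᶠ_ {n}) using (unique?)

  entryAvoiding : Columns n → ℕ → Fin n → ℕ
  entryAvoiding F r x = if F x then 0 else e r (toℕ x)

  entryAvoiding-used : ∀ {F r x} → F x ≡ true → entryAvoiding F r x ≡ 0
  entryAvoiding-used {r = r} {x} Fx = cong (λ b → if b then 0 else e r (toℕ x)) Fx

  entryAvoiding-free : ∀ {F r x} → F x ≡ false → entryAvoiding F r x ≡ e r (toℕ x)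
  entryAvoiding-free {r = r} {x} Fx = cong (λ b → if b then 0 else e r (toℕ x)) Fx

  perRows : ℕ → ℕ → Columns n → ℕ
  perRows zero    r F = 1
  perRows (suc m) r F = ∑ λ x → entryAvoiding F r x * perRows m (suc r) (F ∪｛ x ｝)

  summand : ℕ → ℕ → Columns n → Fin n → ℕ
  summand m r F x = entryAvoiding F r x * perRows m (suc r) (F ∪｛ x ｝)

  perRows-cong : ∀ m r {F G : Columns n} → F ≗ G → perRows m r F ≡ perRows m r G
  perRows-cong zero    r F≗G = refl
  perRows-cong (suc m) r F≗G = sum-cong-≗ λ x →
    cong₂ _*_ (cong (λ b → if b then 0 else e r (toℕ x)) (F≗G x))
              (perRows-cong m (suc r) λ y → cong (_∨ does (x ≟ᶠ y)) (F≗G y))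

  rowProduct : ∀ {m} → ℕ → Vec (Fin n) m → ℕ
  rowProduct r []      = 1
  rowProduct r (x ∷ v) = e r (toℕ x) * rowProduct (suc r) v

  rowProduct-tabulate : ∀ {m} r (v : Vec (Fin n) m) →
    product (tabulate λ s → e (r + toℕ s) (toℕ (lookup v s))) ≡ rowProduct r v
  rowProduct-tabulate r []      = refl
  rowProduct-tabulate r (x ∷ v) = cong₂ _*_
    (cong (λ i → e i (toℕ x)) (ℕ.+-identityʳ r))
    (trans (cong product (tabulate-cong λ s → cong (λ i → e i (toℕ (lookup v s))) (ℕ.+-suc r (toℕ s))))
           (rowProduct-tabulate (suc r) v))

  avoids : Columns n → List (Fin n) → Bool
  avoids F []       = true
  avoids F (x ∷ xs) = not (F x) ∧ avoids F xs

  -- does (unique? (x ∷ xs)) unfolds to distinctFrom x xs ∧ does (unique? xs).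
  distinctFrom : Fin n → List (Fin n) → Bool
  distinctFrom x ys = does (All.all? (λ y → ¬? (x ≟ᶠ y)) ys)

  avoids-∪ : ∀ F x ys → avoids (F ∪｛ x ｝) ys ≡ avoids F ys ∧ distinctFrom x ys
  avoids-∪ F x []       = refl
  avoids-∪ F x (y ∷ ys) rewrite avoids-∪ F x ys with F y | does (x ≟ᶠ y)
  ... | true  | _     = refl
  ... | false | true  = sym (∧-zeroʳ (avoids F ys))
  ... | false | false = refl

  avoids-∅ : ∀ xs → avoids (λ _ → false) xs ≡ true
  avoids-∅ []       = refl
  avoids-∅ (x ∷ xs) = avoids-∅ xs

  weight : ∀ {m} → Columns n → ℕ → Vec (Fin n) m → ℕ
  weight F r v = if avoids F (toList v) ∧ does (unique? (toList v)) then rowProduct r v else 0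

  weight-∷ : ∀ {m} F r x (v : Vec (Fin n) m) →
    weight F r (x ∷ v) ≡ entryAvoiding F r x * weight (F ∪｛ x ｝) (suc r) v
  weight-∷ F r x v with F x
  ... | true  = refl
  ... | false
    rewrite avoids-∪ F x (toList v)
          | ∧-assoc (avoids F (toList v)) (distinctFrom x (toList v)) (does (unique? (toList v)))
          = sym (*-if-0 (e r (toℕ x)) _ (rowProduct (suc r) v))

  sum-weight : ∀ m r F → sum (map (weight F r) (allVecs n m)) ≡ perRows m r F
  sum-weight zero    r F = refl
  sum-weight (suc m) r F = begin
    sum (map (weight F r) (concatMap (λ x → map (x ∷_) (allVecs n m)) (allFin n)))
      ≡⟨ sum-map-concatMap (weight F r) (λ x → map (x ∷_) (allVecs n m)) (allFin n) ⟩
    sum (map (λ x → sum (map (weight F r) (map (x ∷_) (allVecs n m)))) (allFin n))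
      ≡⟨ cong sum (map-cong column (allFin n)) ⟩
    sum (map (λ x → entryAvoiding F r x * perRows m (suc r) (F ∪｛ x ｝)) (allFin n))
      ≡⟨ sum-map-allFin {n} _ ⟩
    perRows (suc m) r F ∎
    where
    column : ∀ x → sum (map (weight F r) (map (x ∷_) (allVecs n m))) ≡ entryAvoiding F r x * perRows m (suc r) (F ∪｛ x ｝)
    column x = begin
      sum (map (weight F r) (map (x ∷_) (allVecs n m)))
        ≡⟨ cong sum (sym (map-∘ (allVecs n m))) ⟩
      sum (map (weight F r ∘ (x ∷_)) (allVecs n m))
        ≡⟨ cong sum (map-cong (weight-∷ F r x) (allVecs n m)) ⟩
      sum (map (λ v → entryAvoiding F r x * weight (F ∪｛ x ｝) (suc r) v) (allVecs n m))
        ≡⟨ sum-map-*ˡ (entryAvoiding F r x) _ (allVecs n m) ⟩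
      entryAvoiding F r x * sum (map (weight (F ∪｛ x ｝) (suc r)) (allVecs n m))
        ≡⟨ cong (_*_ (entryAvoiding F r x)) (sum-weight m (suc r) (F ∪｛ x ｝)) ⟩
      entryAvoiding F r x * perRows m (suc r) (F ∪｛ x ｝) ∎

  per-rowExpansion : (M : Matrix n) → (∀ s t → M s t ≡ e (toℕ s) (toℕ t)) →
    per M ≡ perRows n 0 (λ _ → false)
  per-rowExpansion M M≡e = begin
    per M
      ≡⟨ sum-map-filter (λ σ → unique? (toList σ)) _ (allVecs n n) ⟩
    sum (map (λ σ → if does (unique? (toList σ)) then product (map (λ s → M s (lookup σ s)) (allFin n)) else 0) (allVecs n n))
      ≡⟨ cong sum (map-cong term (allVecs n n)) ⟩
    sum (map (weight (λ _ → false) 0) (allVecs n n))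
      ≡⟨ sum-weight n 0 (λ _ → false) ⟩
    perRows n 0 (λ _ → false) ∎
    where
    term : ∀ σ → (if does (unique? (toList σ)) then product (map (λ s → M s (lookup σ s)) (allFin n)) else 0)
               ≡ weight (λ _ → false) 0 σ
    term σ rewrite avoids-∅ (toList σ) = cong (λ p → if does (unique? (toList σ)) then p else 0)
      (trans (cong product (trans (map-cong (λ s → M≡e s (lookup σ s)) (allFin n)) (map-tabulate id _)))
             (rowProduct-tabulate 0 σ))

-- With no rows left, a hole c < r is a column that no row used.
perHole : (ℕ → ℕ → ℕ) → ℕ → ℕ → ℕ → ℕ
perHole e zero    r c = if does (c ≟ r) then 1 else 0
perHole e (suc m) r c = e r c * perHole e m (suc r) (suc r) + perHole e m (suc r) c

module UnitHessenberg {n : ℕ} (e : ℕ → ℕ → ℕ)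
  (e-super : ∀ r → e r (suc r) ≡ 1) (e-beyond : ∀ r t → suc r < t → e r t ≡ 0) where

  open RowExpansion {n} e

  hole? : ∀ r c t → Dec (t ≤ r × t ≢ c)
  hole? r c t = t ≤? r ×-dec ¬? (t ≟ c)

  -- The columns used by rows 0, …, r − 1 when they occupy {0, …, r} except c.
  Hole : ℕ → ℕ → Columns n
  Hole r c y = does (hole? r c (toℕ y))

  Hole-empty : ∀ y → Hole 0 0 y ≡ false
  Hole-empty y = dec-false (hole? 0 0 (toℕ y)) λ (y≤0 , y≢0) → y≢0 (ℕ.n≤0⇒n≡0 y≤0)

  ∪-fill : ∀ {r c x} → c ≤ r → toℕ x ≡ c → Hole r c ∪｛ x ｝ ≗ Hole (suc r) (suc r)
  ∪-fill {r} {c} {x} c≤r x≡c y =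
    does-⇔ (mk⇔ to from) (hole? r c (toℕ y) ⊎-dec x ≟ᶠ y) (hole? (suc r) (suc r) (toℕ y))
    where
    to : (toℕ y ≤ r × toℕ y ≢ c) ⊎ x ≡ y → toℕ y ≤ suc r × toℕ y ≢ suc r
    to (inj₁ (y≤r , _)) = ℕ.m≤n⇒m≤1+n y≤r , ℕ.<⇒≢ (s≤s y≤r)
    to (inj₂ refl)      = ℕ.m≤n⇒m≤1+n x≤r , ℕ.<⇒≢ (s≤s x≤r)
      where x≤r = subst (_≤ r) (sym x≡c) c≤r
    from : toℕ y ≤ suc r × toℕ y ≢ suc r → (toℕ y ≤ r × toℕ y ≢ c) ⊎ x ≡ y
    from (y≤1+r , y≢1+r) with x ≟ᶠ y
    ... | yes x≡y = inj₂ x≡y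
    ... | no  x≢y = inj₁ (ℕ.≤-pred (ℕ.≤∧≢⇒< y≤1+r y≢1+r) , toℕ-≢ (x≢y ∘ sym) x≡c)

  ∪-extend : ∀ {r c x} → c ≤ r → toℕ x ≡ suc r → Hole r c ∪｛ x ｝ ≗ Hole (suc r) c
  ∪-extend {r} {c} {x} c≤r x≡1+r y =
    does-⇔ (mk⇔ to from) (hole? r c (toℕ y) ⊎-dec x ≟ᶠ y) (hole? (suc r) c (toℕ y))
    where
    to : (toℕ y ≤ r × toℕ y ≢ c) ⊎ x ≡ y → toℕ y ≤ suc r × toℕ y ≢ c
    to (inj₁ (y≤r , y≢c)) = ℕ.m≤n⇒m≤1+n y≤r , y≢c
    to (inj₂ refl)        = ℕ.≤-reflexive x≡1+r , λ x≡c → ℕ.1+n≰n (subst (_≤ r) (trans (sym x≡c) x≡1+r) c≤r)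
    from : toℕ y ≤ suc r × toℕ y ≢ c → (toℕ y ≤ r × toℕ y ≢ c) ⊎ x ≡ y
    from (y≤1+r , y≢c) with x ≟ᶠ y
    ... | yes x≡y = inj₂ x≡y
    ... | no  x≢y = inj₁ (ℕ.≤-pred (ℕ.≤∧≢⇒< y≤1+r (toℕ-≢ (x≢y ∘ sym) x≡1+r)) , y≢c)

  entry-hole : ∀ {r c x} → toℕ x ≡ c → entryAvoiding (Hole r c) r x ≡ e r c
  entry-hole {r} {c} {x} x≡c =
    trans (entryAvoiding-free {Hole r c} (dec-false (hole? r c (toℕ x)) λ (_ , x≢c) → x≢c x≡c)) (cong (e r) x≡c)

  entry-next : ∀ {r c x} → toℕ x ≡ suc r → entryAvoiding (Hole r c) r x ≡ 1
  entry-next {r} {c} {x} x≡1+r = trans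
    (entryAvoiding-free {Hole r c} (dec-false (hole? r c (toℕ x)) λ (x≤r , _) → ℕ.1+n≰n (subst (_≤ r) x≡1+r x≤r)))
    (trans (cong (e r) x≡1+r) (e-super r))

  entry-elsewhere : ∀ {r c x} → toℕ x ≢ c → toℕ x ≢ suc r → entryAvoiding (Hole r c) r x ≡ 0
  entry-elsewhere {r} {c} {x} x≢c x≢1+r with toℕ x ≤? r
  ... | yes x≤r = entryAvoiding-used {Hole r c} (dec-true (hole? r c (toℕ x)) (x≤r , x≢c))
  ... | no  x≰r = trans (entryAvoiding-free {Hole r c} (dec-false (hole? r c (toℕ x)) (x≰r ∘ proj₁)))
                        (e-beyond r (toℕ x) (ℕ.≤∧≢⇒< (ℕ.≰⇒> x≰r) (x≢1+r ∘ sym)))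

  mutual
    perRows-Hole-diag : ∀ m r → m + r ≡ n → perRows m r (Hole r r) ≡ perHole e m r r
    perRows-Hole-diag zero    r _   = sym (cong (λ b → if b then 1 else 0) (dec-true (r ≟ r) refl))
    perRows-Hole-diag (suc m) r m+r = perRows-Hole m r r ℕ.≤-refl m+r

    perRows-Hole : ∀ m r c → c ≤ r → suc m + r ≡ n → perRows (suc m) r (Hole r c) ≡ perHole e (suc m) r c
    perRows-Hole zero r c c≤r 1+r≡n = begin
      ∑ (summand 0 r (Hole r c))          ≡⟨ ∑-single _ xc elsewhere ⟩
      entryAvoiding (Hole r c) r xc * 1   ≡⟨ cong (_* 1) (entry-hole xc≡c) ⟩
      e r c * 1                           ≡⟨ ℕ.+-identityʳ _ ⟨
      e r c * 1 + 0                       ≡⟨ cong₂ (λ p q → e r c * (if p then 1 else 0) + (if q then 1 else 0))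
                                                   (dec-true (suc r ≟ suc r) refl)
                                                   (dec-false (c ≟ suc r) (ℕ.<⇒≢ (s≤s c≤r))) ⟨
      perHole e 1 r c                     ∎
      where
      c<n = subst (c <_) 1+r≡n (s≤s c≤r)
      xc = fromℕ< c<n
      xc≡c = toℕ-fromℕ< c<n
      elsewhere : ∀ x → x ≢ xc → summand 0 r (Hole r c) x ≡ 0
      elsewhere x x≢xc = cong (_* 1) (entry-elsewhere (toℕ-≢ x≢xc xc≡c)
                                                     (λ x≡1+r → ℕ.<-irrefl (trans x≡1+r 1+r≡n) (toℕ<n x)))
    perRows-Hole (suc m) r c c≤r 2+m+r≡n = begin
      ∑ (summand (suc m) r (Hole r c))
        ≡⟨ ∑-pair _ xc x₁ xc≢x₁ elsewhere ⟩
      summand (suc m) r (Hole r c) xc + summand (suc m) r (Hole r c) x₁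
        ≡⟨ cong₂ _+_ (cong₂ _*_ (entry-hole xc≡c) (perRows-cong (suc m) (suc r) (∪-fill c≤r xc≡c)))
                     (cong₂ _*_ (entry-next x₁≡1+r) (perRows-cong (suc m) (suc r) (∪-extend c≤r x₁≡1+r))) ⟩
      e r c * perRows (suc m) (suc r) (Hole (suc r) (suc r)) + 1 * perRows (suc m) (suc r) (Hole (suc r) c)
        ≡⟨ cong₂ (λ p q → e r c * p + q) (perRows-Hole-diag (suc m) (suc r) 1+m+1+r≡n)
                 (trans (ℕ.*-identityˡ _) (perRows-Hole m (suc r) c (ℕ.m≤n⇒m≤1+n c≤r) 1+m+1+r≡n)) ⟩
      perHole e (suc (suc m)) r c ∎
      where
      1+m+1+r≡n = trans (ℕ.+-suc (suc m) r) 2+m+r≡n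
      c<n = subst (c <_) 2+m+r≡n (s≤s (ℕ.≤-trans c≤r (ℕ.m≤n+m r (suc m))))
      1+r<n = subst (suc r <_) 2+m+r≡n (s≤s (s≤s (ℕ.m≤n+m r m)))
      xc = fromℕ< c<n
      xc≡c = toℕ-fromℕ< c<n
      x₁ = fromℕ< 1+r<n
      x₁≡1+r = toℕ-fromℕ< 1+r<n
      xc≢x₁ : xc ≢ x₁
      xc≢x₁ xc≡x₁ = ℕ.<⇒≢ (s≤s c≤r) (trans (sym xc≡c) (trans (cong toℕ xc≡x₁) x₁≡1+r))
      elsewhere : ∀ x → x ≢ xc → x ≢ x₁ → summand (suc m) r (Hole r c) x ≡ 0
      elsewhere x x≢xc x≢x₁ = cong (_* perRows (suc m) (suc r) (Hole r c ∪｛ x ｝)) (entry-elsewhere (toℕ-≢ x≢xc xc≡c) (toℕ-≢ x≢x₁ x₁≡1+r))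

  per≡perHole : (M : Matrix n) → (∀ s t → M s t ≡ e (toℕ s) (toℕ t)) → per M ≡ perHole e n 0 0
  per≡perHole M M≡e = begin
    per M                      ≡⟨ per-rowExpansion M M≡e ⟩
    perRows n 0 (λ _ → false)  ≡⟨ perRows-cong n 0 (sym ∘ Hole-empty) ⟩
    perRows n 0 (Hole 0 0)     ≡⟨ perRows-Hole-diag n 0 (ℕ.+-identityʳ n) ⟩
    perHole e n 0 0            ∎

perGap : (ℕ → ℕ) → ℕ → ℕ → ℕ
perGap w zero    zero    = 1
perGap w zero    (suc g) = 0
perGap w (suc m) g       = w g * perGap w m 0 + perGap w m (suc g)

perHole≡perGap : ∀ e w → (∀ c g → e (c + g) c ≡ w g) → ∀ m c g → perHole e m (c + g) c ≡ perGap w m g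
perHole≡perGap e w e≡w zero c zero =
  cong (λ p → if p then 1 else 0) (dec-true (c ≟ c + 0) (sym (ℕ.+-identityʳ c)))
perHole≡perGap e w e≡w zero c (suc g) =
  cong (λ p → if p then 1 else 0) (dec-false (c ≟ c + suc g) (ℕ.m+1+n≢m c ∘ sym))
perHole≡perGap e w e≡w (suc m) c g = cong₂ _+_
  (cong₂ _*_ (e≡w c g)
    (trans (cong (λ r → perHole e m r (suc (c + g))) (sym (ℕ.+-identityʳ _)))
           (perHole≡perGap e w e≡w m (suc (c + g)) 0)))
  (trans (cong (λ r → perHole e m r c) (sym (ℕ.+-suc c g)))
         (perHole≡perGap e w e≡w m c (suc g)))

band : ℕ → ℤ → ℕ
band k δ = if ⌊ -[1+ 0 ] ℤ.≤? δ ⌋ ∧ ⌊ δ ℤ.<? + k ⌋ then 1 else 0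

d : (k λ' : ℕ) → ℕ → ℕ → ℕ
d k λ' s t = if does (s ≟ t) then λ' else band k (+ s - + t)

gapWeight : (k λ' : ℕ) → ℕ → ℕ
gapWeight k λ' zero    = λ'
gapWeight k λ' (suc g) = if does (suc g <? k) then 1 else 0

module _ (k λ' : ℕ) where

  d-diag : ∀ s → d k λ' s s ≡ λ'
  d-diag s = cong (λ b → if b then λ' else band k (+ s - + s)) (dec-true (s ≟ s) refl)

  d-off : ∀ {s t} → s ≢ t → d k λ' s t ≡ band k (+ s - + t)
  d-off {s} {t} s≢t = cong (λ b → if b then λ' else band k (+ s - + t)) (dec-false (s ≟ t) s≢t)

  D≡d : ∀ n s t → D k λ' n s t ≡ d k λ' (toℕ s) (toℕ t)
  D≡d n s t with s ≟ᶠ t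
  ... | yes refl = sym (d-diag (toℕ s))
  ... | no  s≢t  = sym (d-off (s≢t ∘ toℕ-injective))

  d-super : ∀ s → d k λ' s (suc s) ≡ 1
  d-super s = trans (d-off (ℕ.<⇒≢ (ℕ.n<1+n s)))
    (cong (band k) (trans (ℤ.⊖-< (ℕ.n<1+n s)) (cong (-_ ∘ +_) (ℕ.m+n∸n≡m 1 s))))

  d-beyond : ∀ s t → suc s < t → d k λ' s t ≡ 0
  d-beyond s t 1+s<t = trans (d-off (ℕ.<⇒≢ s<t))
    (trans (cong (band k) (trans (ℤ.m-n≡m⊖n s t) (ℤ.⊖-< s<t))) (band-below (t ∸ s) 2≤t∸s))
    where
    s<t = ℕ.<-trans (ℕ.n<1+n s) 1+s<t
    band-below : ∀ x → 2 ≤ x → band k (- + x) ≡ 0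
    band-below (suc (suc x)) _ = refl
    band-below 1 (s≤s ())
    2≤t∸s : 2 ≤ t ∸ s
    2≤t∸s = subst (_≤ t ∸ s) (ℕ.m+n∸n≡m 2 s) (ℕ.∸-monoˡ-≤ s 1+s<t)

  d-toeplitz : ∀ c g → d k λ' (c + g) c ≡ gapWeight k λ' g
  d-toeplitz c zero    = trans (cong (λ s → d k λ' s c) (ℕ.+-identityʳ c)) (d-diag c)
  d-toeplitz c (suc g) = trans (d-off (ℕ.m+1+n≢m c)) (trans (cong (band k) δ≡1+g) band-1+g)
    where
    δ≡1+g : + (c + suc g) - + c ≡ + suc g
    δ≡1+g = trans (ℤ.m-n≡m⊖n (c + suc g) c)
                  (trans (ℤ.⊖-≥ (ℕ.m≤m+n c (suc g))) (cong +_ (ℕ.m+n∸m≡n c (suc g))))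
    band-1+g : band k (+ suc g) ≡ gapWeight k λ' (suc g)
    band-1+g = cong (λ p → if p then 1 else 0)
                    (trans (⌊⌋-map′ _ _ (suc g <? k)) (isYes≗does (suc g <? k)))

sum-take-zeros : ∀ t s l → sum (take t (replicate s 0 ++ l)) ≡ sum (take (t ∸ s) l)
sum-take-zeros t       zero    l = refl
sum-take-zeros zero    (suc s) l = refl
sum-take-zeros (suc t) (suc s) l = sum-take-zeros t s l

<ᵇ-true : ∀ {m n} → m < n → (m <ᵇ n) ≡ true
<ᵇ-true {m} {n} = dec-true (m <? n)

<ᵇ-false : ∀ {m n} → n ≤ m → (m <ᵇ n) ≡ false
<ᵇ-false {m} {n} n≤m = dec-false (m <? n) (ℕ.≤⇒≯ n≤m)

module OrderK (K λ' : ℕ) where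

  private
    k = suc (suc K)

  b : ℕ → ℕ
  b = shifted k λ' k

  h : ℕ → List ℕ
  h = hist k λ' k

  b-initial : ∀ j → j < suc K → b (suc j) ≡ 0
  b-initial j j<1+K
    rewrite <ᵇ-true j<1+K | dec-false (suc j + k ≟ k) (ℕ.m+1+n≢m k ∘ trans (ℕ.+-comm k (suc j))) = refl

  hist-initial : ∀ j → j ≤ suc K → h j ≡ replicate j 0 ++ 1 ∷ []
  hist-initial zero    _       = cong (λ p → (if p then 1 else 0) ∷ []) (dec-true (k ≟ k) refl)
  hist-initial (suc j) 1+j≤1+K = cong₂ _∷_ (b-initial j 1+j≤1+K) (hist-initial j (ℕ.m≤n⇒m≤1+n (ℕ.≤-pred 1+j≤1+K)))

  b-step : ∀ j → K ≤ j → b (suc (suc j)) ≡ λ' * b (suc j) + sum (take (suc K) (h j))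
  b-step j K≤j rewrite <ᵇ-false K≤j = refl

  private
    w = gapWeight k λ'

  mutual
    perGap-closed : ∀ m → perGap w m 0 ≡ b (suc (suc (m + K)))
    perGap-closed zero = sym (begin
      b (suc (suc K))                          ≡⟨ b-step K ℕ.≤-refl ⟩
      λ' * b (suc K) + sum (take (suc K) (h K)) ≡⟨ cong₂ (λ x y → λ' * x + y) (b-initial K ℕ.≤-refl) window ⟩
      λ' * 0 + 1                               ≡⟨ cong (_+ 1) (ℕ.*-zeroʳ λ') ⟩
      1                                        ∎)
      where
      window : sum (take (suc K) (h K)) ≡ 1
      window = begin
        sum (take (suc K) (h K))                        ≡⟨ cong (sum ∘ take (suc K)) (hist-initial K (ℕ.n≤1+n K)) ⟩
        sum (take (suc K) (replicate K 0 ++ 1 ∷ []))    ≡⟨ sum-take-zeros (suc K) K (1 ∷ []) ⟩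
        sum (take (suc K ∸ K) (1 ∷ []))                 ≡⟨ cong (λ t → sum (take t (1 ∷ []))) (ℕ.m+n∸n≡m 1 K) ⟩
        1                                               ∎
    perGap-closed (suc m) = begin
      λ' * perGap w m 0 + perGap w m 1          ≡⟨ cong₂ (λ x y → λ' * x + y) (perGap-closed m) (perGap-open m 0) ⟩
      λ' * b (suc (suc (m + K))) + sum (take (suc K) (h (suc (m + K))))
                                                ≡⟨ b-step (suc (m + K)) (ℕ.m≤n⇒m≤1+n (ℕ.m≤n+m K m)) ⟨
      b (suc (suc (suc (m + K))))               ∎

    perGap-open : ∀ m g → perGap w m (suc g) ≡ sum (take (suc K ∸ g) (h (suc (m + K))))
    perGap-open zero g = sym (begin
      sum (take (suc K ∸ g) (h (suc K)))                          ≡⟨ cong (sum ∘ take (suc K ∸ g)) (hist-initial (suc K) ℕ.≤-refl) ⟩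
      sum (take (suc K ∸ g) (replicate (suc K) 0 ++ 1 ∷ []))      ≡⟨ sum-take-zeros (suc K ∸ g) (suc K) (1 ∷ []) ⟩
      sum (take (suc K ∸ g ∸ suc K) (1 ∷ []))                     ≡⟨ cong (λ t → sum (take t (1 ∷ []))) (ℕ.m≤n⇒m∸n≡0 (ℕ.m∸n≤m (suc K) g)) ⟩
      0                                                           ∎)
    perGap-open (suc m) g with g ≤? K
    ... | yes g≤K = begin
      w (suc g) * perGap w m 0 + perGap w m (suc (suc g))
        ≡⟨ cong₂ (λ x y → w (suc g) * x + y) (perGap-closed m) (perGap-open m (suc g)) ⟩
      w (suc g) * b₀ + sum (take (K ∸ g) (h (suc (m + K))))
        ≡⟨ cong (λ c → (if c then 1 else 0) * b₀ + window) (dec-true (suc g <? k) (s≤s (s≤s g≤K))) ⟩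
      1 * b₀ + sum (take (K ∸ g) (h (suc (m + K))))
        ≡⟨ cong (_+ window) (ℕ.*-identityˡ b₀) ⟩
      sum (take (suc (K ∸ g)) (h (suc (suc (m + K)))))
        ≡⟨ cong (λ t → sum (take t (h (suc (suc (m + K)))))) (ℕ.+-∸-assoc 1 g≤K) ⟨
      sum (take (suc K ∸ g) (h (suc (suc (m + K))))) ∎
      where
      b₀ = b (suc (suc (m + K)))
      window = sum (take (K ∸ g) (h (suc (m + K))))
    ... | no  g≰K = begin
      w (suc g) * perGap w m 0 + perGap w m (suc (suc g))
        ≡⟨ cong₂ (λ c y → (if c then 1 else 0) * perGap w m 0 + y)
                 (dec-false (suc g <? k) (g≰K ∘ ℕ.≤-pred ∘ ℕ.≤-pred)) (perGap-open m (suc g)) ⟩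
      sum (take (K ∸ g) (h (suc (m + K))))
        ≡⟨ cong (λ t → sum (take t (h (suc (m + K))))) (ℕ.m≤n⇒m∸n≡0 (ℕ.<⇒≤ (ℕ.≰⇒> g≰K))) ⟩
      0
        ≡⟨ cong (λ t → sum (take t (h (suc (suc (m + K)))))) (ℕ.m≤n⇒m∸n≡0 (ℕ.≰⇒> g≰K)) ⟨
      sum (take (suc K ∸ g) (h (suc (suc (m + K))))) ∎

  a≡b : ∀ n → a k λ' k (+ (n + 1)) ≡ b (suc (suc (n + K)))
  a≡b n rewrite ℕ.+-comm n 1 = cong b (trans (ℕ.+-suc n (suc K)) (cong suc (ℕ.+-suc n K)))

theorem1p17 : (k λ' : ℕ) → 2 ≤ k → 1 ≤ λ' → (n : ℕ) → 1 ≤ n →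
    per (D k λ' n) ≡ a k λ' k (+ (n + 1))
-- The identity also holds for λ' = 0 and for n = 0.
theorem1p17 (suc (suc K)) λ' (s≤s (s≤s z≤n)) _ n _ = begin
  per (D k λ' n)                      ≡⟨ per≡perHole (D k λ' n) (D≡d k λ' n) ⟩
  perHole (d k λ') n 0 0              ≡⟨ perHole≡perGap (d k λ') (gapWeight k λ') (d-toeplitz k λ') n 0 0 ⟩
  perGap (gapWeight k λ') n 0         ≡⟨ perGap-closed n ⟩
  shifted k λ' k (suc (suc (n + K)))  ≡⟨ a≡b n ⟨
  a k λ' k (+ (n + 1))                ∎
  where
  k = suc (suc K)
  open UnitHessenberg {n} (d k λ') (d-super k λ') (d-beyond k λ')
  open OrderK K λ'
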